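{- In the propositional system described in the context, for variables $a,b$ the object $(\varnothing\Rightarrow a)\Rightarrow(b\Rightarrow a)$ is derivable.
   Context: Objects are generated from the constant $\varnothing$ by: $(\alpha)^{\mathsf c}$, $(\alpha)^{\mathsf v}$ (variables are the objects of this form), $(\alpha\,\&\,\beta)$, $(\alpha\Rightarrow\beta)$, $(\alpha\cap\beta)$. $\bot:=\varnothing^{\mathsf c}$. $\alpha[x:=\beta]$ is $\alpha$ with every appearance of the variable $x$ (not guarded by a stop) replaced by $\beta$. Rules: R1 (Exchange) from $\alpha$ and $\alpha\Rightarrow\beta$ infer $\beta$; R2 (Substitution) from $\alpha$ infer $\alpha[x:=\beta]$ for any object $\beta$ and variable $x$. Axioms ($a,b,c,d$ variables): A1 $((c\Rightarrow a)\&(c\Rightarrow(a\Rightarrow b)))\Rightarrow(c\Rightarrow b)$; A2 $((d\Rightarrow(a\Rightarrow b))\&(d\Rightarrow(b\Rightarrow c)))\Rightarrow(d\Rightarrow(a\Rightarrow c))$; A3 $((c\Rightarrow a)\&(c\Rightarrow b))\Rightarrow(c\Rightarrow(a\&b))$; A4a $(a\&b)\Rightarrow a$; A4b $(a\&b)\Rightarrow b$; A5a $a\Rightarrow(a\cap b)$; A5b $b\Rightarrow(a\cap b)$; A6 $((a\Rightarrow c)\&(b\Rightarrow c))\Rightarrow((a\cap b)\Rightarrow c)$; A7 $a\Rightarrow a$; A8 $a\Rightarrow\varnothing$; A9 $\bot\Rightarrow a$; A10 $(\varnothing\Rightarrow a)\Rightarrow((\varnothing\Rightarrow b)\Rightarrow(a\&b))$;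 A11 $(a\Rightarrow b)\Rightarrow(\varnothing\Rightarrow(a\Rightarrow b))$; A12 $(((a\Rightarrow b)\Rightarrow\bot)\Rightarrow\bot)\Rightarrow(a\Rightarrow b)$. An object is derivable if it is the last step of a finite list each of whose steps is an axiom or follows from earlier steps by R1 or R2. -}

module Defs where

open import Relation.Binary.PropositionalEquality using (_≡_; refl)
open import Relation.Nullary using (Dec; yes; no)

infixr 4 _⇒_
infixr 6 _&_
infixr 5 _∩_
data Obj : Set where
  ∅   : Obj
  _ᶜ  : Obj → Obj
  _ᵛ  : Obj → Obj
  _&_ : Obj → Obj → Obj
  _⇒_ : Obj → Obj → Obj
  _∩_ : Obj → Obj → Obj

⊥o : Obj
⊥o = ∅ ᶜ

data IsVar : Obj → Set where
  isVar : (α : Obj) → IsVar (α ᵛ)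

_≟_ : (α β : Obj) → Dec (α ≡ β)
∅ ≟ ∅ = yes refl
∅ ≟ (β ᶜ) = no (λ ())
∅ ≟ (β ᵛ) = no (λ ())
∅ ≟ (β & β₁) = no (λ ())
∅ ≟ (β ⇒ β₁) = no (λ ())
∅ ≟ (β ∩ β₁) = no (λ ())
(α ᶜ) ≟ ∅ = no (λ ())
(α ᶜ) ≟ (β ᶜ) with α ≟ β
... | yes refl = yes refl
... | no ne = no (λ { refl → ne refl })
(α ᶜ) ≟ (β ᵛ) = no (λ ())
(α ᶜ) ≟ (β & β₁) = no (λ ())
(α ᶜ) ≟ (β ⇒ β₁) = no (λ ())
(α ᶜ) ≟ (β ∩ β₁) = no (λ ())
(α ᵛ) ≟ ∅ = no (λ ())
(α ᵛ) ≟ (β ᶜ) = no (λ ())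
(α ᵛ) ≟ (β ᵛ) with α ≟ β
... | yes refl = yes refl
... | no ne = no (λ { refl → ne refl })
(α ᵛ) ≟ (β & β₁) = no (λ ())
(α ᵛ) ≟ (β ⇒ β₁) = no (λ ())
(α ᵛ) ≟ (β ∩ β₁) = no (λ ())
(α & α₁) ≟ ∅ = no (λ ())
(α & α₁) ≟ (β ᶜ) = no (λ ())
(α & α₁) ≟ (β ᵛ) = no (λ ())
(α & α₁) ≟ (β & β₁) with α ≟ β | α₁ ≟ β₁
... | yes refl | yes refl = yes refl
... | no ne | _ = no (λ { refl → ne refl })
... | yes _ | no ne = no (λ { refl → ne refl })
(α & α₁) ≟ (β ⇒ β₁) = no (λ ())
(α & α₁) ≟ (β ∩ β₁) = no (λ ())
(α ⇒ α₁) ≟ ∅ = no (λ ())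
(α ⇒ α₁) ≟ (β ᶜ) = no (λ ())
(α ⇒ α₁) ≟ (β ᵛ) = no (λ ())
(α ⇒ α₁) ≟ (β & β₁) = no (λ ())
(α ⇒ α₁) ≟ (β ⇒ β₁) with α ≟ β | α₁ ≟ β₁
... | yes refl | yes refl = yes refl
... | no ne | _ = no (λ { refl → ne refl })
... | yes _ | no ne = no (λ { refl → ne refl })
(α ⇒ α₁) ≟ (β ∩ β₁) = no (λ ())
(α ∩ α₁) ≟ ∅ = no (λ ())
(α ∩ α₁) ≟ (β ᶜ) = no (λ ())
(α ∩ α₁) ≟ (β ᵛ) = no (λ ())
(α ∩ α₁) ≟ (β & β₁) = no (λ ())
(α ∩ α₁) ≟ (β ⇒ β₁) = no (λ ())
(α ∩ α₁) ≟ (β ∩ β₁) with α ≟ β | α₁ ≟ β₁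
... | yes refl | yes refl = yes refl
... | no ne | _ = no (λ { refl → ne refl })
... | yes _ | no ne = no (λ { refl → ne refl })

-- α [ x := β ] : replace every appearance of the variable x in α that is
-- not guarded by a stop ( ᶜ ) by β.  Variables are atomic: a variable is
-- either x itself (replaced) or a different variable (left unchanged).
_[_:=_] : Obj → Obj → Obj → Obj
∅ [ x := β ] = ∅
(α ᶜ) [ x := β ] = α ᶜ
(α ᵛ) [ x := β ] with (α ᵛ) ≟ x
... | yes _ = β
... | no _ = α ᵛ
(α & γ) [ x := β ] = (α [ x := β ]) & (γ [ x := β ])
(α ⇒ γ) [ x := β ] = (α [ x := β ]) ⇒ (γ [ x := β ])
(α ∩ γ) [ x := β ] = (α [ x := β ]) ∩ (γ [ x := β ])

va vb vc vd : Obj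
va = ∅ ᵛ
vb = (∅ ᵛ) ᵛ
vc = ((∅ ᵛ) ᵛ) ᵛ
vd = (((∅ ᵛ) ᵛ) ᵛ) ᵛ

data Axiom : Obj → Set where
  A1  : Axiom (((vc ⇒ va) & (vc ⇒ (va ⇒ vb))) ⇒ (vc ⇒ vb))
  A2  : Axiom (((vd ⇒ (va ⇒ vb)) & (vd ⇒ (vb ⇒ vc))) ⇒ (vd ⇒ (va ⇒ vc)))
  A3  : Axiom (((vc ⇒ va) & (vc ⇒ vb)) ⇒ (vc ⇒ (va & vb)))
  A4a : Axiom ((va & vb) ⇒ va)
  A4b : Axiom ((va & vb) ⇒ vb)
  A5a : Axiom (va ⇒ (va ∩ vb))
  A5b : Axiom (vb ⇒ (va ∩ vb))
  A6  : Axiom (((va ⇒ vc) & (vb ⇒ vc)) ⇒ ((va ∩ vb) ⇒ vc))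
  A7  : Axiom (va ⇒ va)
  A8  : Axiom (va ⇒ ∅)
  A9  : Axiom (⊥o ⇒ va)
  A10 : Axiom ((∅ ⇒ va) ⇒ ((∅ ⇒ vb) ⇒ (va & vb)))
  A11 : Axiom ((va ⇒ vb) ⇒ (∅ ⇒ (va ⇒ vb)))
  A12 : Axiom ((((va ⇒ vb) ⇒ ⊥o) ⇒ ⊥o) ⇒ (va ⇒ vb))

data Derivable : Obj → Set where
  ax  : ∀ {α} → Axiom α → Derivable α
  r1  : ∀ {α β} → Derivable α → Derivable (α ⇒ β) → Derivable β
  r2  : ∀ {α} (x β : Obj) → IsVar x → Derivable α → Derivable (α [ x := β ])

module Submission where

-- Writing □A for ∅ ⇒ A: A8 gives □A ⇒ ∅ and B ⇒ ∅,
-- necessitation (from A11) puts derivable implications under ∅, and the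
-- transitivity axiom A2 chains  □A ⇒ ∅  with  ∅ ⇒ (B ⇒ ∅)  (under ∅, which is
-- itself derivable) to  □A ⇒ (B ⇒ ∅),  and then that with  □A ⇒ (∅ ⇒ A)  (A7)
-- to  □A ⇒ (B ⇒ A).
--
-- The real work is to use the axioms at arbitrary objects.  R2 substitutes
-- for one variable at a time, and substituting for a after b (say) would also
-- rewrite the value already chosen for b.  So the first part of the file
-- shows that every instance of an axiom schema is derivable (instantiate):
-- the schema variables are renamed one by one to variables too large to occur
-- in any chosen value, and these are then replaced one by one by the values.

open import Data.Nat using (ℕ; zero; suc; _+_; _<_; _≤_; _<?_; s≤s; s≤s⁻¹)
open import Data.Nat.Properties
  using (suc-injective; +-cancelˡ-≡; ≤-refl; ≤-trans; <-trans; <-≤-trans; <-irrefl; <-asym;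
         <-cmp; <⇒≤; <⇒≱; >⇒≢; m≤m+n; m≤n+m; m≤n⇒m≤o+n; n<1+n; m<n⇒m<1+n; m<1+n⇒m<n∨m≡n)
open import Data.Fin using (Fin; toℕ) renaming (zero to fzero; suc to fsuc)
open import Data.Fin.Properties using (toℕ<n)
open import Data.List using (List; []; _∷_)
open import Data.Bool using (if_then_else_)
open import Data.Sum using (inj₁; inj₂)
open import Data.Empty using (⊥-elim)
open import Function using (_∘_)
open import Relation.Binary.Definitions using (tri<; tri≈; tri>)
open import Relation.Binary.PropositionalEquality
  using (_≡_; _≢_; refl; sym; trans; cong; cong₂; subst; module ≡-Reasoning)
open import Relation.Nullary using (¬_; does; yes; no)
open import Relation.Nullary.Decidable using (dec-true; dec-false)
open import Defs

-- The number of constructors in an object; a variable occurring in γ is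
-- never larger than γ.
size : Obj → ℕ
size ∅       = 0
size (α ᶜ)   = suc (size α)
size (α ᵛ)   = suc (size α)
size (α & β) = suc (size α + size β)
size (α ⇒ β) = suc (size α + size β)
size (α ∩ β) = suc (size α + size β)

left< : ∀ m n → m < suc (m + n)
left< m n = s≤s (m≤m+n m n)

right< : ∀ m n → n < suc (m + n)
right< m n = s≤s (m≤n+m n m)

subst-fresh : ∀ γ {x} β → size γ < size x → γ [ x := β ] ≡ γ
subst-fresh ∅       β γ<x = refl
subst-fresh (α ᶜ)   β γ<x = refl
subst-fresh (α ᵛ) {x} β γ<x with (α ᵛ) ≟ x
... | yes refl = ⊥-elim (<-irrefl refl γ<x)
... | no _     = refl
subst-fresh (α & γ) β γ<x =
  cong₂ _&_ (subst-fresh α β (<-trans (left< _ _) γ<x)) (subst-fresh γ β (<-trans (right< _ _) γ<x))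
subst-fresh (α ⇒ γ) β γ<x =
  cong₂ _⇒_ (subst-fresh α β (<-trans (left< _ _) γ<x)) (subst-fresh γ β (<-trans (right< _ _) γ<x))
subst-fresh (α ∩ γ) β γ<x =
  cong₂ _∩_ (subst-fresh α β (<-trans (left< _ _) γ<x)) (subst-fresh γ β (<-trans (right< _ _) γ<x))

subst-hit : ∀ {x} β → IsVar x → x [ x := β ] ≡ β
subst-hit β (isVar α) with (α ᵛ) ≟ (α ᵛ)
... | yes _ = refl
... | no ne = ⊥-elim (ne refl)

subst-miss : ∀ {y x} β → IsVar y → y ≢ x → y [ x := β ] ≡ y
subst-miss {x = x} β (isVar α) y≢x with (α ᵛ) ≟ x
... | yes y≡x = ⊥-elim (y≢x y≡x)
... | no _    = refl

-- The numbered variables: var 0, …, var 3 are the axiom variables a, b, c, d.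
var : ℕ → Obj
var zero    = ∅ ᵛ
var (suc i) = var i ᵛ

var-isVar : ∀ i → IsVar (var i)
var-isVar zero    = isVar ∅
var-isVar (suc i) = isVar (var i)

size-var : ∀ i → size (var i) ≡ suc i
size-var zero    = refl
size-var (suc i) = cong suc (size-var i)

var-injective : ∀ {i j} → var i ≡ var j → i ≡ j
var-injective {i} {j} eq = suc-injective (trans (sym (size-var i)) (trans (cong size eq) (size-var j)))

var-miss : ∀ {i j} β → i ≢ j → var i [ var j := β ] ≡ var i
var-miss β i≢j = subst-miss β (var-isVar _) (i≢j ∘ var-injective)

infixr 4 _⇒ˢ_
infixr 6 _&ˢ_
infixr 5 _∩ˢ_
data Schema (n : ℕ) : Set where
  meta            : Fin n → Schema n
  ∅ˢ ⊥ˢ           : Schema n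
  _&ˢ_ _⇒ˢ_ _∩ˢ_ : Schema n → Schema n → Schema n

Env : Set
Env = ℕ → Obj

⟦_⟧ : ∀ {n} → Schema n → Env → Obj
⟦ meta i ⟧  ρ = ρ (toℕ i)
⟦ ∅ˢ ⟧      ρ = ∅
⟦ ⊥ˢ ⟧      ρ = ⊥o
⟦ S &ˢ T ⟧ ρ = ⟦ S ⟧ ρ & ⟦ T ⟧ ρ
⟦ S ⇒ˢ T ⟧ ρ = ⟦ S ⟧ ρ ⇒ ⟦ T ⟧ ρ
⟦ S ∩ˢ T ⟧ ρ = ⟦ S ⟧ ρ ∩ ⟦ T ⟧ ρ

_≐[_]_ : Env → ℕ → Env → Set
ρ ≐[ n ] σ = ∀ {i} → i < n → ρ i ≡ σ i

⟦⟧-cong : ∀ {n} (S : Schema n) {ρ σ} → ρ ≐[ n ] σ → ⟦ S ⟧ ρ ≡ ⟦ S ⟧ σ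
⟦⟧-cong (meta i)  ρ≐σ = ρ≐σ (toℕ<n i)
⟦⟧-cong ∅ˢ        ρ≐σ = refl
⟦⟧-cong ⊥ˢ        ρ≐σ = refl
⟦⟧-cong (S &ˢ T) ρ≐σ = cong₂ _&_ (⟦⟧-cong S ρ≐σ) (⟦⟧-cong T ρ≐σ)
⟦⟧-cong (S ⇒ˢ T) ρ≐σ = cong₂ _⇒_ (⟦⟧-cong S ρ≐σ) (⟦⟧-cong T ρ≐σ)
⟦⟧-cong (S ∩ˢ T) ρ≐σ = cong₂ _∩_ (⟦⟧-cong S ρ≐σ) (⟦⟧-cong T ρ≐σ)

⟦⟧-subst : ∀ {n} (S : Schema n) ρ x β → ⟦ S ⟧ ρ [ x := β ] ≡ ⟦ S ⟧ (λ i → ρ i [ x := β ])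
⟦⟧-subst (meta i)  ρ x β = refl
⟦⟧-subst ∅ˢ        ρ x β = refl
⟦⟧-subst ⊥ˢ        ρ x β = refl
⟦⟧-subst (S &ˢ T) ρ x β = cong₂ _&_ (⟦⟧-subst S ρ x β) (⟦⟧-subst T ρ x β)
⟦⟧-subst (S ⇒ˢ T) ρ x β = cong₂ _⇒_ (⟦⟧-subst S ρ x β) (⟦⟧-subst T ρ x β)
⟦⟧-subst (S ∩ˢ T) ρ x β = cong₂ _∩_ (⟦⟧-subst S ρ x β) (⟦⟧-subst T ρ x β)

subst-instance : ∀ {n} (S : Schema n) {ρ σ x β} → IsVar x →
  (λ i → ρ i [ x := β ]) ≐[ n ] σ → Derivable (⟦ S ⟧ ρ) → Derivable (⟦ S ⟧ σ)
subst-instance S {ρ} {σ} {x} {β} x-var ρ[x:=β]≐σ d =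
  subst Derivable (trans (⟦⟧-subst S ρ x β) (⟦⟧-cong S ρ[x:=β]≐σ)) (r2 x β x-var d)

splice : ℕ → Env → Env → Env
splice k σ ρ i = if does (i <? k) then σ i else ρ i

splice-below : ∀ σ ρ {k i} → i < k → splice k σ ρ i ≡ σ i
splice-below σ ρ {k} {i} i<k rewrite dec-true (i <? k) i<k = refl

splice-above : ∀ σ ρ {k i} → ¬ i < k → splice k σ ρ i ≡ ρ i
splice-above σ ρ {k} {i} i≮k rewrite dec-false (i <? k) i≮k = refl

-- The variables ρ 0, …, ρ (n-1) can be replaced by σ 0, …, σ (n-1) in this
-- order: no replacement captures an earlier value, nor a later variable.
record Replaceable (n : ℕ) (ρ σ : Env) : Set where
  field
    variables  : ∀ {k} → k < n → IsVar (ρ k)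
    no-capture : ∀ {i k} → i < k → k < n → σ i [ ρ k := σ k ] ≡ σ i
    distinct   : ∀ {i k} → k < i → i < n → ρ i [ ρ k := σ k ] ≡ ρ i

module _ {n ρ σ} (R : Replaceable n ρ σ) where
  open Replaceable R

  splice-step : ∀ {k} → k < n → (λ i → splice k σ ρ i [ ρ k := σ k ]) ≐[ n ] splice (suc k) σ ρ
  splice-step {k} k<n {i} i<n with <-cmp i k
  ... | tri< i<k _ _ = begin
    splice k σ ρ i [ ρ k := σ k ]  ≡⟨ cong (_[ ρ k := σ k ]) (splice-below σ ρ i<k) ⟩
    σ i [ ρ k := σ k ]             ≡⟨ no-capture i<k k<n ⟩
    σ i                            ≡⟨ sym (splice-below σ ρ (m<n⇒m<1+n i<k)) ⟩
    splice (suc k) σ ρ i           ∎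
    where open ≡-Reasoning
  ... | tri≈ _ refl _ = begin
    splice k σ ρ k [ ρ k := σ k ]  ≡⟨ cong (_[ ρ k := σ k ]) (splice-above σ ρ (<-irrefl refl)) ⟩
    ρ k [ ρ k := σ k ]             ≡⟨ subst-hit (σ k) (variables k<n) ⟩
    σ k                            ≡⟨ sym (splice-below σ ρ (n<1+n k)) ⟩
    splice (suc k) σ ρ k           ∎
    where open ≡-Reasoning
  ... | tri> _ _ k<i = begin
    splice k σ ρ i [ ρ k := σ k ]  ≡⟨ cong (_[ ρ k := σ k ]) (splice-above σ ρ (<-asym k<i)) ⟩
    ρ i [ ρ k := σ k ]             ≡⟨ distinct k<i i<n ⟩
    ρ i                            ≡⟨ sym (splice-above σ ρ (<⇒≱ k<i ∘ s≤s⁻¹)) ⟩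
    splice (suc k) σ ρ i           ∎
    where open ≡-Reasoning

  replace-prefix : ∀ (S : Schema n) k → k ≤ n → Derivable (⟦ S ⟧ ρ) → Derivable (⟦ S ⟧ (splice k σ ρ))
  replace-prefix S zero    _   d = subst Derivable (⟦⟧-cong S (λ _ → sym (splice-above σ ρ {0} λ ()))) d
  replace-prefix S (suc k) k<n d =
    subst-instance S (variables k<n) (splice-step k<n) (replace-prefix S k (<⇒≤ k<n) d)

  replace : ∀ (S : Schema n) → Derivable (⟦ S ⟧ ρ) → Derivable (⟦ S ⟧ σ)
  replace S d = subst Derivable (⟦⟧-cong S (splice-below σ ρ)) (replace-prefix S n ≤-refl d)

mass : ℕ → Env → ℕ
mass zero    τ = 0
mass (suc n) τ = size (τ n) + mass n τ

size≤mass : ∀ {i n} τ → i < n → size (τ i) ≤ mass n τ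
size≤mass {i} {suc n} τ i<1+n with m<1+n⇒m<n∨m≡n i<1+n
... | inj₁ i<n  = m≤n⇒m≤o+n (size (τ n)) (size≤mass τ i<n)
... | inj₂ refl = m≤m+n (size (τ i)) (mass i τ)

-- Variables beyond var 0, …, var (n-1) and beyond everything in τ 0, …, τ (n-1).
fresh : ℕ → Env → Env
fresh n τ k = var (n + mass n τ + k)

module _ (n : ℕ) (τ : Env) where
  private
    N : ℕ
    N = n + mass n τ

  rename-to-fresh : Replaceable n var (fresh n τ)
  rename-to-fresh = record
    { variables  = λ _ → var-isVar _
    ; no-capture = λ {i} _ k<n → var-miss _ (>⇒≢ (<-≤-trans k<n (≤-trans (m≤m+n n _) (m≤m+n N i))))
    ; distinct   = λ k<i _ → var-miss _ (>⇒≢ k<i)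
    }

  fresh-to-values : Replaceable n (fresh n τ) τ
  fresh-to-values = record
    { variables  = λ _ → var-isVar _
    ; no-capture = λ {i} {k} i<k k<n → subst-fresh (τ i) (τ k) (smaller-than-fresh (<-trans i<k k<n))
    ; distinct   = λ k<i _ → var-miss _ (>⇒≢ k<i ∘ +-cancelˡ-≡ N _ _)
    }
    where
    smaller-than-fresh : ∀ {i k} → i < n → size (τ i) < size (fresh n τ k)
    smaller-than-fresh {i} {k} i<n rewrite size-var (N + k) =
      s≤s (≤-trans (size≤mass τ i<n) (≤-trans (m≤n+m (mass n τ) n) (m≤m+n N k)))

instantiate : ∀ {n} (S : Schema n) → Derivable (⟦ S ⟧ var) → (τ : Env) → Derivable (⟦ S ⟧ τ)
instantiate {n} S d τ = replace (fresh-to-values n τ) S (replace (rename-to-fresh n τ) S d)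

env : List Obj → Env
env []       i       = ∅
env (α ∷ αs) zero    = α
env (α ∷ αs) (suc i) = env αs i

a : ∀ {n} → Schema (suc n)
a = meta fzero

b : ∀ {n} → Schema (suc (suc n))
b = meta (fsuc fzero)

c : ∀ {n} → Schema (suc (suc (suc n)))
c = meta (fsuc (fsuc fzero))

d : ∀ {n} → Schema (suc (suc (suc (suc n))))
d = meta (fsuc (fsuc (fsuc fzero)))

-- Instances of the axioms used below.  A7 and A8 have a single variable, so
-- one application of R2 suffices for them.
A2-instance : ∀ D X Y Z → Derivable (((D ⇒ (X ⇒ Y)) & (D ⇒ (Y ⇒ Z))) ⇒ (D ⇒ (X ⇒ Z)))
A2-instance D X Y Z =
  instantiate {4} (((d ⇒ˢ (a ⇒ˢ b)) &ˢ (d ⇒ˢ (b ⇒ˢ c))) ⇒ˢ (d ⇒ˢ (a ⇒ˢ c))) (ax A2) (env (X ∷ Y ∷ Z ∷ D ∷ []))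

A7-instance : ∀ X → Derivable (X ⇒ X)
A7-instance X = r2 va X (isVar ∅) (ax A7)

A8-instance : ∀ X → Derivable (X ⇒ ∅)
A8-instance X = r2 va X (isVar ∅) (ax A8)

A10-instance : ∀ X Y → Derivable ((∅ ⇒ X) ⇒ ((∅ ⇒ Y) ⇒ (X & Y)))
A10-instance X Y = instantiate {2} ((∅ˢ ⇒ˢ a) ⇒ˢ ((∅ˢ ⇒ˢ b) ⇒ˢ (a &ˢ b))) (ax A10) (env (X ∷ Y ∷ []))

A11-instance : ∀ X Y → Derivable ((X ⇒ Y) ⇒ (∅ ⇒ (X ⇒ Y)))
A11-instance X Y = instantiate {2} ((a ⇒ˢ b) ⇒ˢ (∅ˢ ⇒ˢ (a ⇒ˢ b))) (ax A11) (env (X ∷ Y ∷ []))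

-- ∅ itself is derivable (A8 applied to the derivable a ⇒ a), so a boxed
-- object ∅ ⇒ X can be discharged.
∅-derivable : Derivable ∅
∅-derivable = r1 (A7-instance va) (A8-instance (va ⇒ va))

discharge : ∀ {X} → Derivable (∅ ⇒ X) → Derivable X
discharge = r1 ∅-derivable

necessitate : ∀ {X Y} → Derivable (X ⇒ Y) → Derivable (∅ ⇒ (X ⇒ Y))
necessitate {X} {Y} d = r1 d (A11-instance X Y)

pair : ∀ {X Y} → Derivable (∅ ⇒ X) → Derivable (∅ ⇒ Y) → Derivable (X & Y)
pair {X} {Y} dX dY = r1 dY (r1 dX (A10-instance X Y))

compose-under : ∀ {D X Y Z} → Derivable (D ⇒ (X ⇒ Y)) → Derivable (D ⇒ (Y ⇒ Z)) →
  Derivable (D ⇒ (X ⇒ Z))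
compose-under {D} {X} {Y} {Z} dXY dYZ =
  r1 (pair (necessitate dXY) (necessitate dYZ)) (A2-instance D X Y Z)

boxed-weakening : ∀ A B → Derivable ((∅ ⇒ A) ⇒ (B ⇒ A))
boxed-weakening A B = compose-under box⇒[B⇒∅] (A7-instance (∅ ⇒ A))
  where
  box⇒[B⇒∅] : Derivable ((∅ ⇒ A) ⇒ (B ⇒ ∅))
  box⇒[B⇒∅] = discharge (compose-under (necessitate (A8-instance (∅ ⇒ A)))
                                       (necessitate (necessitate (A8-instance B))))

lemma2p1 : (a b : Obj) → IsVar a → IsVar b →
    Derivable ((∅ ⇒ a) ⇒ (b ⇒ a))
lemma2p1 a b _ _ = boxed-weakening a b
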